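{- Let $X$ be a set with two ternary relations $R,S$, let $E_R$ be a set of relational units for $R$ and $E_S$ a set of relational units for $S$, and suppose that for all $t,u,v,w,x\in X$: $(\exists y,z.\ S^y_{tu}\wedge R^x_{yz}\wedge S^z_{vw})\Rightarrow(\exists y,z.\ R^y_{tv}\wedge S^x_{yz}\wedge R^z_{uw})$. Then $E_R\subseteq E_S$. Moreover, if $E_S\subseteq E_R$, then for all $u,v,w,x\in X$: $R^x_{uv}\Rightarrow S^x_{uv}$; $R^x_{uv}\Rightarrow S^x_{vu}$; $(\exists y.\ R^x_{uy}\wedge S^y_{vw})\Rightarrow(\exists y.\ R^y_{uv}\wedge S^x_{yw})$; $(\exists y.\ S^y_{uv}\wedge R^x_{yw})\Rightarrow(\exists y.\ S^x_{uy}\wedge R^y_{vw})$; $(\exists y.\ R^x_{uy}\wedge S^y_{vw})\Rightarrow(\exists y.\ S^x_{vy}\wedge R^y_{uw})$; $(\exists y.\ S^y_{uv}\wedge R^x_{yw})\Rightarrow(\exists y.\ R^y_{uw}\wedge S^x_{yv})$.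
   Context: $R^x_{yz}$ means the ternary relation $R$ holds at $(x,y,z)$. $E$ is a set of relational units for $R$ if for all $x,y$: $\exists e\in E.\ R^x_{ex}$; $R^x_{ey}\wedge e\in E\Rightarrow x=y$; $\exists e\in E.\ R^x_{xe}$; $R^x_{ye}\wedge e\in E\Rightarrow x=y$. -}

module Defs where

open import Data.Product using (Σ; ∃; _×_; ∃-syntax)
open import Relation.Binary.PropositionalEquality using (_≡_)

-- A ternary relation on X: Rel₃ X, with  R x y z  meaning  R^x_{yz}.
Rel₃ : Set → Set₁
Rel₃ X = X → X → X → Set

Subset : Set → Set₁
Subset X = X → Set

_⊆_ : {X : Set} → Subset X → Subset X → Set
A ⊆ B = ∀ {x} → A x → B x

record IsRelUnits {X : Set} (R : Rel₃ X) (E : Subset X) : Set where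
  field
    left-exists  : ∀ x → ∃[ e ] (E e × R x e x)
    left-unique  : ∀ x y e → E e → R x e y → x ≡ y
    right-exists : ∀ x → ∃[ e ] (E e × R x x e)
    right-unique : ∀ x y e → E e → R x y e → x ≡ y

Interchange : {X : Set} → Rel₃ X → Rel₃ X → Set
Interchange {X} R S = ∀ t u v w x →
  (∃[ y ] ∃[ z ] (S y t u × R x y z × S z v w)) →
  (∃[ y ] ∃[ z ] (R y t v × S x y z × R z u w))

-- Write R^x_{yz} as "x ∈ y ·R z".  Every
-- argument below is an instance of the Eckmann–Hilton trick: pad one side of
-- a relation with an S-unit, apply interchange, and collapse the resulting
-- R-relations whose argument is a unit by the uniqueness axioms of units.
module Submission where

open import Defs
open import Data.Product using (_×_; ∃-syntax; _,_)
open import Relation.Binary.PropositionalEquality using (_≡_; subst; subst₂; sym)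

-- A relational unit is idempotent: e ∈ E implies R^e_{ee}.  The left unit e'
-- of e satisfies R^e_{e'e}, and right uniqueness for the unit e forces e' = e.
unit-idempotent : {X : Set} {R : Rel₃ X} {E : Subset X} →
  IsRelUnits R E → ∀ {e} → E e → R e e e
unit-idempotent {R = R} U {e} eE =
  let (e' , _ , Ree'e) = left-exists e
  in subst (λ k → R e k e) (sym (right-unique e e' e eE Ree'e)) Ree'e
  where open IsRelUnits U

module Interchange-with-units
  {X : Set} {R S : Rel₃ X} {E-R E-S : Subset X}
  (UR : IsRelUnits R E-R) (US : IsRelUnits S E-S) (I : Interchange R S)
  where

  module UR = IsRelUnits UR
  module US = IsRelUnits US

  -- For e ∈ E_R with S-units f, g satisfying
  -- S^e_{fe} and S^e_{eg}, interchange of e ∈ (f ·S e) ·R (e ·S g) yields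
  -- e ∈ (f ·R e) ·S (e ·R g) = f ·S g, so S^e_{fg}, and the left S-unit f
  -- then gives e = g ∈ E_S.
  units-included : E-R ⊆ E-S
  units-included {e} eR =
    let (f , fS , Sefe) = US.left-exists e
        (g , gS , Seeg) = US.right-exists e
        (y , z , Ryfe , Seyz , Rzeg) =
          I f e e g e (e , e , Sefe , unit-idempotent UR eR , Seeg)
        Sefg : S e f g
        Sefg = subst₂ (S e) (UR.right-unique y f e eR Ryfe)
                            (UR.left-unique z g e eR Rzeg) Seyz
    in subst E-S (sym (US.left-unique e g f fS Sefg)) gS

  module Coinciding-units (S-units-are-R-units : E-S ⊆ E-R) where

    collapseʳ : ∀ {y t g} → E-S g → R y t g → y ≡ t
    collapseʳ {y} {t} gS = UR.right-unique y t _ (S-units-are-R-units gS)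

    collapseˡ : ∀ {y g v} → E-S g → R y g v → y ≡ v
    collapseˡ {y} {_} {v} gS = UR.left-unique y v _ (S-units-are-R-units gS)

    -- R^x_{uv} ⇒ S^x_{uv}: interchange (u ·S g) ·R (f ·S v).
    R⇒S : ∀ {u v x} → R x u v → S x u v
    R⇒S {u} {v} {x} r =
      let (g , gS , Sug) = US.right-exists u
          (f , fS , Sfv) = US.left-exists v
          (y , z , Ryuf , Sxyz , Rzgv) = I u g f v x (u , v , Sug , r , Sfv)
      in subst₂ (S x) (collapseʳ fS Ryuf) (collapseˡ gS Rzgv) Sxyz

    -- R^x_{uv} ⇒ S^x_{vu}: interchange (g ·S u) ·R (v ·S f).
    R⇒S-swapped : ∀ {u v x} → R x u v → S x v u
    R⇒S-swapped {u} {v} {x} r =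
      let (g , gS , Sgu) = US.left-exists u
          (f , fS , Svf) = US.right-exists v
          (y , z , Rygv , Sxyz , Rzuf) = I g u v f x (u , v , Sgu , r , Svf)
      in subst₂ (S x) (collapseˡ gS Rygv) (collapseʳ fS Rzuf) Sxyz

    -- u ·R (v ·S w) ⊆ (u ·R v) ·S w: interchange (u ·S g) ·R (v ·S w).
    R-S-assoc : ∀ {u v w x} →
      ∃[ y ] (R x u y × S y v w) → ∃[ y ] (R y u v × S x y w)
    R-S-assoc {u} {v} {w} {x} (y , r , s) =
      let (g , gS , Sug) = US.right-exists u
          (y' , z , Ry'uv , Sxy'z , Rzgw) = I u g v w x (u , y , Sug , r , s)
      in y' , Ry'uv , subst (S x y') (collapseˡ gS Rzgw) Sxy'z

    -- (u ·S v) ·R w ⊆ u ·S (v ·R w): interchange (u ·S v) ·R (g ·S w).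
    S-R-assoc : ∀ {u v w x} →
      ∃[ y ] (S y u v × R x y w) → ∃[ y ] (S x u y × R y v w)
    S-R-assoc {u} {v} {w} {x} (y , s , r) =
      let (g , gS , Sgw) = US.left-exists w
          (y' , z , Ry'ug , Sxy'z , Rzvw) = I u v g w x (y , w , s , r , Sgw)
      in z , subst (λ k → S x k z) (collapseʳ gS Ry'ug) Sxy'z , Rzvw

    -- u ·R (v ·S w) ⊆ v ·S (u ·R w): interchange (g ·S u) ·R (v ·S w).
    R-S-exchange : ∀ {u v w x} →
      ∃[ y ] (R x u y × S y v w) → ∃[ y ] (S x v y × R y u w)
    R-S-exchange {u} {v} {w} {x} (y , r , s) =
      let (g , gS , Sgu) = US.left-exists u
          (y' , z , Ry'gv , Sxy'z , Rzuw) = I g u v w x (u , y , Sgu , r , s)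
      in z , subst (λ k → S x k z) (collapseˡ gS Ry'gv) Sxy'z , Rzuw

    -- (u ·S v) ·R w ⊆ (u ·R w) ·S v: interchange (u ·S v) ·R (w ·S g).
    S-R-exchange : ∀ {u v w x} →
      ∃[ y ] (S y u v × R x y w) → ∃[ y ] (R y u w × S x y v)
    S-R-exchange {u} {v} {w} {x} (y , s , r) =
      let (g , gS , Swg) = US.right-exists w
          (y' , z , Ry'uw , Sxy'z , Rzvg) = I u v w g x (y , w , s , r , Swg)
      in y' , Ry'uw , subst (S x y') (collapseʳ gS Rzvg) Sxy'z

lemma5p2 : (X : Set) (R S : Rel₃ X) (E-R E-S : Subset X) →
    IsRelUnits R E-R → IsRelUnits S E-S → Interchange R S →
    (E-R ⊆ E-S) ×
    (E-S ⊆ E-R →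
      (∀ u v w x →
        (R x u v → S x u v) ×
        (R x u v → S x v u) ×
        ((∃[ y ] (R x u y × S y v w)) → ∃[ y ] (R y u v × S x y w)) ×
        ((∃[ y ] (S y u v × R x y w)) → ∃[ y ] (S x u y × R y v w)) ×
        ((∃[ y ] (R x u y × S y v w)) → ∃[ y ] (S x v y × R y u w)) ×
        ((∃[ y ] (S y u v × R x y w)) → ∃[ y ] (R y u w × S x y v))))
lemma5p2 _ _ _ _ _ UR US I = units-included , λ S-units-are-R-units _ _ _ _ →
  let open Coinciding-units S-units-are-R-units
  in R⇒S , R⇒S-swapped , R-S-assoc , S-R-assoc , R-S-exchange , S-R-exchange
  where open Interchange-with-units UR US I
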